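{- Let $k$ be an even positive integer, let $s,\tilde s,f,\tilde f$ be horizontal dominoes and $b_1,\dots,b_k$ blocks, all with entries in a commutative ring. Then \[ \det(s b_1\cdots b_k\tilde f)\det(\tilde s b_1\cdots b_k f)-\det(s b_1\cdots b_k f)\det(\tilde s b_1\cdots b_k\tilde f) =\det\begin{bmatrix} s\\ \tilde s\end{bmatrix}\cdot\prod_{i=1}^k\det b_i\cdot\det\begin{bmatrix}\tilde f\\ f\end{bmatrix}. \]
   Context: A horizontal domino is a $1\times2$ matrix, a vertical domino a $2\times1$ matrix, a block a $2\times2$ matrix. For a sequence $X_0,X_1,\dots,X_n$ of dominoes and blocks, the DRH matrix $X_0X_1\cdots X_n$ is formed by placing the pieces successively as arrays of unit cells, each $X_t$ either directly above $X_{t-1}$ (bottom edge on top edge of $X_{t-1}$, left edges aligned) or directly to the right of $X_{t-1}$ (left edge on right edge of $X_{t-1}$, bottom edges aligned), the directions alternating and starting with "above" when $X_0$ is a horizontal domino; the matrix is the bounding rectangle with the pieces' entries and $0$ elsewhere, rows read top to bottom and columns left to right. Here all such matrices are square. $\begin{bmatrix} u\\ u'\end{bmatrix}$ denotes the $2\times2$ matrix with top row $u$ and bottom row $u'$; $\det b$ of a block is taken with its rows in their given (top-to-bottom) order. -}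

module Defs where

open import Level using (Level)
open import Algebra.Bundles using (CommutativeRing)
open import Data.Nat using (ℕ; zero; suc; _∸_; _≤ᵇ_; _<ᵇ_) renaming (_+_ to _+ℕ_)
open import Data.Bool using (Bool; if_then_else_; _∧_)
open import Data.Fin using (Fin; toℕ; punchIn) renaming (zero to fz; suc to fs)
open import Data.List using (List; []; _∷_; _++_; map; tabulate)

module DRH {c ℓ : Level} (R : CommutativeRing c ℓ) where
  open CommutativeRing R

  -- n × n matrices, entry M i j = row i (top to bottom), column j (left to right)
  Matrix : ℕ → Set c
  Matrix n = Fin n → Fin n → Carrier

  -- a horizontal domino [u 0, u 1]; a block b (rows top to bottom)
  Domino : Set c
  Domino = Fin 2 → Carrier

  Block : Set c
  Block = Matrix 2

  sumFin : (n : ℕ) → (Fin n → Carrier) → Carrier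
  sumFin zero    g = 0#
  sumFin (suc n) g = g fz + sumFin n (λ i → g (fs i))

  prodFin : (n : ℕ) → (Fin n → Carrier) → Carrier
  prodFin zero    g = 1#
  prodFin (suc n) g = g fz * prodFin n (λ i → g (fs i))

  sgn : ℕ → Carrier
  sgn zero    = 1#
  sgn (suc m) = - sgn m

  det : {n : ℕ} → Matrix n → Carrier
  det {zero}  M = 1#
  det {suc n} M =
    sumFin (suc n) (λ j → sgn (toℕ j) * M fz j * det {n} (λ i j' → M (fs i) (punchIn j j')))

  stack : Domino → Domino → Block
  stack u u' fz     = u
  stack u u' (fs _) = u'

  -- pieces: horizontal domino, vertical domino (entry 0 on top), block
  data Piece : Set c where
    hdom : Domino → Piece
    vdom : (Fin 2 → Carrier) → Piece
    blk  : Block → Piece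

  width height : Piece → ℕ
  width (hdom _) = 2
  width (vdom _) = 1
  width (blk _)  = 2
  height (hdom _) = 1
  height (vdom _) = 2
  height (blk _)  = 2

  fin2 : ℕ → Fin 2
  fin2 zero    = fz
  fin2 (suc _) = fs fz

  -- entry of a piece at local (row from top, column from left)
  pieceAt : Piece → ℕ → ℕ → Carrier
  pieceAt (hdom u) i j = u (fin2 j)
  pieceAt (vdom v) i j = v (fin2 i)
  pieceAt (blk b)  i j = b (fin2 i) (fin2 j)

  data Dir : Set where
    above right : Dir

  flip : Dir → Dir
  flip above = right
  flip right = above

  -- piece p has its bottom-left cell at (x , y) (x = column, y = row counted
  -- from the bottom); the next piece is placed in direction d relative to p,
  -- and directions alternate.  Value at cell (r , c) (r from the bottom).
  nextX nextY : Dir → ℕ → ℕ → Piece → ℕ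
  nextX above x y p = x
  nextX right x y p = x +ℕ width p
  nextY above x y p = y +ℕ height p
  nextY right x y p = y

  place : ℕ → ℕ → Dir → Piece → List Piece → ℕ → ℕ → Carrier
  place x y d p ps r c =
    if (x ≤ᵇ c) ∧ (c <ᵇ x +ℕ width p) ∧ (y ≤ᵇ r) ∧ (r <ᵇ y +ℕ height p)
    then pieceAt p ((y +ℕ height p ∸ 1) ∸ r) (c ∸ x)
    else rest ps
    where
    rest : List Piece → Carrier
    rest []       = 0#
    rest (q ∷ qs) = place (nextX d x y p) (nextY d x y p) (flip d) q qs r c

  -- The DRH matrix X₀ X₁ ⋯ Xₘ with X₀ = s a horizontal domino (so the
  -- directions start with "above"), as an n × n matrix (n = side of the
  -- square bounding rectangle); rows are read top to bottom.
  drh : (n : ℕ) → Domino → List Piece → Matrix n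
  drh n s Xs i j = place 0 0 above (hdom s) Xs ((n ∸ 1) ∸ toℕ i) (toℕ j)

  -- s b₁ ⋯ bₖ f  (a (k+2) × (k+2) matrix when k is even)
  drhSBF : (k : ℕ) → Domino → (Fin k → Block) → Domino → Matrix (k +ℕ 2)
  drhSBF k s b f = drh (k +ℕ 2) s (map blk (tabulate b) ++ (hdom f ∷ []))

-- Expanding along the top row, which carries only the entries of f, gives
-- det (s b₁ ⋯ bₖ f) = f₀ A₀(s) − f₁ A₁(s), where A_j(s) is the determinant of
-- s b₁ ⋯ bₖ with one of its last two columns deleted.  A polynomial identity
-- turns the left-hand side into (A₁(s) A₀(s̃) − A₀(s) A₁(s̃)) · det [f̃; f].
-- Putting two more blocks U, V on top transforms (A₀, A₁) by a 2 × 2 matrix of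
-- determinant det U · det V (expand along the two new rows), so by induction on
-- k/2 this "Wronskian" equals det [s; s̃] · ∏ det bᵢ.

module Submission where

open import Defs
open import Level using (Level)
open import Algebra.Bundles using (CommutativeRing)
open import Data.Nat using (ℕ; _<_)
open import Data.Nat.Divisibility using (_∣_; divides)
open import Data.Fin using (Fin)

open import Data.Nat as ℕ using (zero; suc; _≤_; _∸_; z≤n; s≤s; _≤ᵇ_; _<ᵇ_; _<?_)
import Data.Nat.Properties as ℕ
open import Data.Fin using (toℕ; punchIn) renaming (zero to fz; suc to fs)
open import Data.Integer as ℤ using (ℤ; +_; -[1+_]; _⊖_; ∣_∣; sign; _◃_)
import Data.Integer.Properties as ℤ
open import Data.Sign as Sign using (Sign)
open import Data.Bool using (Bool; true; false; if_then_else_; _∧_)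
open import Data.Bool.Properties using (∧-zeroʳ)
open import Data.List using (List; []; _∷_; _++_; map; tabulate)
open import Data.Maybe as Maybe using (Maybe)
open import Data.Unit using (tt)
open import Function using (_∘_)
open import Relation.Nullary using (yes; no)
open import Relation.Binary.Definitions using (tri<; tri≈; tri>)
open import Relation.Nullary.Negation using (contradiction)
open import Relation.Binary.Consequences using (dec⇒weaklyDec)
open import Relation.Binary.PropositionalEquality as ≡ using (_≡_; _≗_)
open import Algebra.Solver.Ring.AlmostCommutativeRing using (fromCommutativeRing; _-Raw-AlmostCommutative⟶_)

double : ℕ → ℕ
double zero    = zero
double (suc m) = suc (suc (double m))

double≡*2 : ∀ m → double m ≡ m ℕ.* 2
double≡*2 zero    = ≡.refl
double≡*2 (suc m) = ≡.cong (suc ∘ suc) (double≡*2 m)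

module IntegerCoefficientSolver {c ℓ : Level} (R : CommutativeRing c ℓ) where
  open CommutativeRing R hiding (zero)
  open import Relation.Binary.Reasoning.Setoid setoid
  open import Algebra.Properties.Semiring.Mult.TCOptimised semiring using (_×_; 1+×; ×-homo-+; ×1-homo-*)
  open import Algebra.Properties.Ring ring using (-1*x≈-x)
  open import Algebra.Properties.AbelianGroup +-abelianGroup using (⁻¹-∙-comm)
  open import Algebra.Properties.Group +-group using (ε⁻¹≈ε; ⁻¹-involutive)
  open import Algebra.Properties.CommutativeSemigroup +-commutativeSemigroup
    using () renaming (interchange to +-interchange)
  open import Algebra.Properties.CommutativeSemigroup *-commutativeSemigroup
    using () renaming (interchange to *-interchange)

  -- The optimised multiple has 1 × 1# = 1# definitionally, so con (+ 1) evaluates to 1#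
  -- itself; the solver calls below on unfolded determinants rely on this.
  fromℕ : ℕ → Carrier
  fromℕ n = n × 1#

  fromℤ : ℤ → Carrier
  fromℤ (+ n)    = fromℕ n
  fromℤ -[1+ n ] = - fromℕ (suc n)

  fromSign : Sign → Carrier
  fromSign Sign.+ = 1#
  fromSign Sign.- = - 1#

  x-0≈x : ∀ x → x - 0# ≈ x
  x-0≈x x = trans (+-congˡ ε⁻¹≈ε) (+-identityʳ x)

  [1+x]-[1+y]≈x-y : ∀ x y → (1# + x) - (1# + y) ≈ x - y
  [1+x]-[1+y]≈x-y x y = begin
    (1# + x) + - (1# + y)    ≈⟨ +-congˡ (⁻¹-∙-comm 1# y) ⟨
    (1# + x) + (- 1# + - y)  ≈⟨ +-interchange 1# x (- 1#) (- y) ⟩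
    (1# - 1#) + (x - y)      ≈⟨ +-congʳ (-‿inverseʳ 1#) ⟩
    0# + (x - y)             ≈⟨ +-identityˡ (x - y) ⟩
    x - y                    ∎

  fromℤ-⊖ : ∀ m n → fromℤ (m ⊖ n) ≈ fromℕ m - fromℕ n
  fromℤ-⊖ zero    zero    = sym (x-0≈x 0#)
  fromℤ-⊖ (suc m) zero    = sym (x-0≈x (fromℕ (suc m)))
  fromℤ-⊖ zero    (suc n) = sym (+-identityˡ _)
  fromℤ-⊖ (suc m) (suc n) = begin
    fromℤ (suc m ⊖ suc n)            ≡⟨ ≡.cong fromℤ (ℤ.[1+m]⊖[1+n]≡m⊖n m n) ⟩
    fromℤ (m ⊖ n)                    ≈⟨ fromℤ-⊖ m n ⟩
    fromℕ m - fromℕ n                ≈⟨ [1+x]-[1+y]≈x-y (fromℕ m) (fromℕ n) ⟨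
    (1# + fromℕ m) - (1# + fromℕ n)  ≈⟨ +-cong (1+× m 1#) (-‿cong (1+× n 1#)) ⟨
    fromℕ (suc m) - fromℕ (suc n)    ∎

  fromℤ-+ : ∀ i j → fromℤ (i ℤ.+ j) ≈ fromℤ i + fromℤ j
  fromℤ-+ (+ m)    (+ n)    = ×-homo-+ 1# m n
  fromℤ-+ (+ m)    -[1+ n ] = fromℤ-⊖ m (suc n)
  fromℤ-+ -[1+ m ] (+ n)    = trans (fromℤ-⊖ n (suc m)) (+-comm _ _)
  fromℤ-+ -[1+ m ] -[1+ n ] = begin
    - fromℕ (suc (suc (m ℕ.+ n)))      ≡⟨ ≡.cong (λ k → - fromℕ (suc k)) (ℕ.+-suc m n) ⟨
    - fromℕ (suc m ℕ.+ suc n)          ≈⟨ -‿cong (×-homo-+ 1# (suc m) (suc n)) ⟩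
    - (fromℕ (suc m) + fromℕ (suc n))  ≈⟨ ⁻¹-∙-comm _ _ ⟨
    - fromℕ (suc m) + - fromℕ (suc n)  ∎

  fromSign-* : ∀ s t → fromSign (s Sign.* t) ≈ fromSign s * fromSign t
  fromSign-* Sign.+ t      = sym (*-identityˡ _)
  fromSign-* Sign.- Sign.+ = sym (*-identityʳ _)
  fromSign-* Sign.- Sign.- = sym (trans (-1*x≈-x _) (⁻¹-involutive _))

  fromℤ-◃ : ∀ s n → fromℤ (s ◃ n) ≈ fromSign s * fromℕ n
  fromℤ-◃ s      zero    = sym (zeroʳ _)
  fromℤ-◃ Sign.+ (suc n) = sym (*-identityˡ _)
  fromℤ-◃ Sign.- (suc n) = sym (-1*x≈-x _)

  fromℤ-* : ∀ i j → fromℤ (i ℤ.* j) ≈ fromℤ i * fromℤ j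
  fromℤ-* i j = begin
    fromℤ (sign i Sign.* sign j ◃ ∣ i ∣ ℕ.* ∣ j ∣)
      ≈⟨ fromℤ-◃ (sign i Sign.* sign j) (∣ i ∣ ℕ.* ∣ j ∣) ⟩
    fromSign (sign i Sign.* sign j) * fromℕ (∣ i ∣ ℕ.* ∣ j ∣)
      ≈⟨ *-cong (fromSign-* (sign i) (sign j)) (×1-homo-* ∣ i ∣ ∣ j ∣) ⟩
    (fromSign (sign i) * fromSign (sign j)) * (fromℕ ∣ i ∣ * fromℕ ∣ j ∣)
      ≈⟨ *-interchange _ _ _ _ ⟩
    (fromSign (sign i) * fromℕ ∣ i ∣) * (fromSign (sign j) * fromℕ ∣ j ∣)
      ≈⟨ *-cong (fromℤ-◃ (sign i) ∣ i ∣) (fromℤ-◃ (sign j) ∣ j ∣) ⟨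
    fromℤ (sign i ◃ ∣ i ∣) * fromℤ (sign j ◃ ∣ j ∣)
      ≡⟨ ≡.cong₂ (λ x y → fromℤ x * fromℤ y) (ℤ.◃-inverse i) (ℤ.◃-inverse j) ⟩
    fromℤ i * fromℤ j
      ∎

  fromℤ-neg : ∀ i → fromℤ (ℤ.- i) ≈ - fromℤ i
  fromℤ-neg (+ zero)  = sym ε⁻¹≈ε
  fromℤ-neg (+ suc n) = refl
  fromℤ-neg -[1+ n ]  = sym (⁻¹-involutive _)

  fromℤ-homomorphism : ℤ.+-*-rawRing -Raw-AlmostCommutative⟶ fromCommutativeRing R
  fromℤ-homomorphism = record
    { ⟦_⟧    = fromℤ
    ; +-homo = fromℤ-+
    ; *-homo = fromℤ-*
    ; -‿homo = fromℤ-neg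
    ; 0-homo = refl
    ; 1-homo = refl
    }

  fromℤ-≟ : ∀ i j → Maybe (fromℤ i ≈ fromℤ j)
  fromℤ-≟ i j = Maybe.map (λ { ≡.refl → refl }) (dec⇒weaklyDec ℤ._≟_ i j)

  open import Algebra.Solver.Ring ℤ.+-*-rawRing (fromCommutativeRing R) fromℤ-homomorphism fromℤ-≟ public

module GridDeterminant {c ℓ : Level} (R : CommutativeRing c ℓ) where
  open CommutativeRing R hiding (zero)
  open DRH R using (Matrix; sumFin; prodFin; sgn; det)
  open IntegerCoefficientSolver R using (solve; _:=_; _:+_; _:*_; _:-_; :-_; con)
  open import Relation.Binary.Reasoning.Setoid setoid
  open import Algebra.Properties.Group +-group using (⁻¹-involutive)

  Grid : Set c
  Grid = ℕ → ℕ → Carrier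

  sumℕ : ℕ → (ℕ → Carrier) → Carrier
  sumℕ zero    g = 0#
  sumℕ (suc n) g = g 0 + sumℕ n (λ j → g (suc j))

  prodℕ : ℕ → (ℕ → Carrier) → Carrier
  prodℕ zero    g = 1#
  prodℕ (suc n) g = g 0 * prodℕ n (λ j → g (suc j))

  punchInℕ : ℕ → ℕ → ℕ
  punchInℕ zero    c       = suc c
  punchInℕ (suc j) zero    = zero
  punchInℕ (suc j) (suc c) = suc (punchInℕ j c)

  removeColumn : ℕ → Grid → Grid
  removeColumn j M r c = M r (punchInℕ j c)

  dropRow : Grid → Grid
  dropRow M r = M (suc r)

  infixr 5 _◂_
  _◂_ : (ℕ → Carrier) → Grid → Grid
  (row ◂ M) zero    = row
  (row ◂ M) (suc r) = M r

  shiftRight : ℕ → (ℕ → Carrier) → ℕ → Carrier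
  shiftRight zero    g c       = g c
  shiftRight (suc o) g zero    = 0#
  shiftRight (suc o) g (suc c) = shiftRight o g c

  detℕ : ℕ → Grid → Carrier
  detℕ zero    M = 1#
  detℕ (suc n) M = sumℕ (suc n) (λ j → sgn j * M 0 j * detℕ n (removeColumn j (dropRow M)))

  VanishesFrom : ℕ → Grid → Set ℓ
  VanishesFrom w M = ∀ r c → w ≤ c → M r c ≈ 0#

  sumℕ-cong : ∀ n {g h : ℕ → Carrier} → (∀ j → g j ≈ h j) → sumℕ n g ≈ sumℕ n h
  sumℕ-cong zero    g≈h = refl
  sumℕ-cong (suc n) g≈h = +-cong (g≈h 0) (sumℕ-cong n (g≈h ∘ suc))

  sumℕ-vanishes : ∀ n (g : ℕ → Carrier) → (∀ j → j < n → g j ≈ 0#) → sumℕ n g ≈ 0#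
  sumℕ-vanishes zero    g g≈0 = refl
  sumℕ-vanishes (suc n) g g≈0 = begin
    g 0 + sumℕ n (g ∘ suc)  ≈⟨ +-cong (g≈0 0 (s≤s z≤n)) (sumℕ-vanishes n (g ∘ suc) (λ j j<n → g≈0 (suc j) (s≤s j<n))) ⟩
    0# + 0#                 ≈⟨ +-identityˡ 0# ⟩
    0#                      ∎

  sumFin≈sumℕ : ∀ n (g : Fin n → Carrier) (h : ℕ → Carrier) → (∀ i → g i ≈ h (toℕ i)) → sumFin n g ≈ sumℕ n h
  sumFin≈sumℕ zero    g h g≈h = refl
  sumFin≈sumℕ (suc n) g h g≈h = +-cong (g≈h fz) (sumFin≈sumℕ n (g ∘ fs) (h ∘ suc) (g≈h ∘ fs))

  prodFin≈prodℕ : ∀ n (g : Fin n → Carrier) (h : ℕ → Carrier) → (∀ i → g i ≈ h (toℕ i)) → prodFin n g ≈ prodℕ n h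
  prodFin≈prodℕ zero    g h g≈h = refl
  prodFin≈prodℕ (suc n) g h g≈h = *-cong (g≈h fz) (prodFin≈prodℕ n (g ∘ fs) (h ∘ suc) (g≈h ∘ fs))

  prodℕ-snoc : ∀ n g → prodℕ (suc n) g ≈ prodℕ n g * g n
  prodℕ-snoc zero    g = *-comm (g 0) 1#
  prodℕ-snoc (suc n) g = trans (*-congˡ (prodℕ-snoc n (g ∘ suc))) (sym (*-assoc _ _ _))

  detℕ-cong : ∀ n {M N : Grid} → (∀ r c → M r c ≈ N r c) → detℕ n M ≈ detℕ n N
  detℕ-cong zero    M≈N = refl
  detℕ-cong (suc n) {M} {N} M≈N = sumℕ-cong (suc n)
    {λ j → sgn j * M 0 j * detℕ n (removeColumn j (dropRow M))}
    {λ j → sgn j * N 0 j * detℕ n (removeColumn j (dropRow N))} (λ j →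
    *-cong (*-congˡ (M≈N 0 j)) (detℕ-cong n (λ r c → M≈N (suc r) (punchInℕ j c))))

  toℕ-punchIn : ∀ {n} (j : Fin (suc n)) (c : Fin n) → toℕ (punchIn j c) ≡ punchInℕ (toℕ j) (toℕ c)
  toℕ-punchIn fz     c      = ≡.refl
  toℕ-punchIn (fs j) fz     = ≡.refl
  toℕ-punchIn (fs j) (fs c) = ≡.cong suc (toℕ-punchIn j c)

  det≈detℕ : ∀ n (A : Matrix n) (M : Grid) → (∀ i j → A i j ≈ M (toℕ i) (toℕ j)) → det A ≈ detℕ n M
  det≈detℕ zero    A M A≈M = refl
  det≈detℕ (suc n) A M A≈M =
    sumFin≈sumℕ (suc n) _ (λ j → sgn j * M 0 j * detℕ n (removeColumn j (dropRow M))) (λ j →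
    *-cong (*-congˡ (A≈M fz j)) (det≈detℕ n _ _ (λ r c →
      trans (A≈M (fs r) (punchIn j c)) (reflexive (≡.cong (M (suc (toℕ r))) (toℕ-punchIn j c))))))

  det-2×2 : (M : Matrix 2) → det M ≈ M fz fz * M (fs fz) (fs fz) - M fz (fs fz) * M (fs fz) fz
  det-2×2 M = solve 4 (λ a b c d →
      con (+ 1) :* a :* (con (+ 1) :* d :* con (+ 1) :+ con (+ 0))
        :+ ((:- con (+ 1)) :* b :* (con (+ 1) :* c :* con (+ 1) :+ con (+ 0)) :+ con (+ 0))
      := a :* d :- b :* c)
    refl (M fz fz) (M fz (fs fz)) (M (fs fz) fz) (M (fs fz) (fs fz))

  punchInℕ-< : ∀ {a c} → c < a → punchInℕ a c ≡ c
  punchInℕ-< {suc a} {zero}  c<a       = ≡.refl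
  punchInℕ-< {suc a} {suc c} (s≤s c<a) = ≡.cong suc (punchInℕ-< c<a)

  punchInℕ-≥ : ∀ {a c} → a ≤ c → punchInℕ a c ≡ suc c
  punchInℕ-≥ {zero}  {c}     a≤c       = ≡.refl
  punchInℕ-≥ {suc a} {suc c} (s≤s a≤c) = ≡.cong suc (punchInℕ-≥ a≤c)

  removeColumn-beyond : ∀ {w M} a → VanishesFrom w M → w ≤ a → ∀ r c → removeColumn a M r c ≈ M r c
  removeColumn-beyond {w} {M} a M≈0 w≤a r c with c <? a
  ... | yes c<a = reflexive (≡.cong (M r) (punchInℕ-< c<a))
  ... | no  c≮a = begin
    M r (punchInℕ a c)  ≡⟨ ≡.cong (M r) (punchInℕ-≥ a≤c) ⟩
    M r (suc c)         ≈⟨ M≈0 r (suc c) (ℕ.m≤n⇒m≤1+n w≤c) ⟩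
    0#                  ≈⟨ M≈0 r c w≤c ⟨
    M r c               ∎
    where
    a≤c = ℕ.≮⇒≥ c≮a
    w≤c = ℕ.≤-trans w≤a a≤c

  removeColumn-vanishesFrom : ∀ {w M} a → VanishesFrom (suc w) M → a ≤ w → VanishesFrom w (removeColumn a M)
  removeColumn-vanishesFrom {w} {M} a M≈0 a≤w r c w≤c =
    trans (reflexive (≡.cong (M r) (punchInℕ-≥ (ℕ.≤-trans a≤w w≤c)))) (M≈0 r (suc c) (s≤s w≤c))

  detℕ-zeroColumn : ∀ n M z → z < n → (∀ r → M r z ≈ 0#) → detℕ n M ≈ 0#
  detℕ-zeroColumn (suc n) M z z<n Mz≈0 = sumℕ-vanishes (suc n) _ term≈0
    where
    term≈0 : ∀ j → j < suc n → sgn j * M 0 j * detℕ n (removeColumn j (dropRow M)) ≈ 0#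
    term≈0 j j<n with ℕ.<-cmp j z
    ... | tri≈ _ ≡.refl _ = trans (*-congʳ (trans (*-congˡ (Mz≈0 0)) (zeroʳ _))) (zeroˡ _)
    ... | tri< (s≤s j≤z′) _ _ = trans (*-congˡ (detℕ-zeroColumn n _ _ (ℕ.≤-pred z<n) (λ r →
            trans (reflexive (≡.cong (M (suc r)) (punchInℕ-≥ j≤z′))) (Mz≈0 (suc r))))) (zeroʳ _)
    ... | tri> _ _ z<j = trans (*-congˡ (detℕ-zeroColumn n _ z (ℕ.<-≤-trans z<j (ℕ.≤-pred j<n)) (λ r →
            trans (reflexive (≡.cong (M (suc r)) (punchInℕ-< z<j))) (Mz≈0 (suc r))))) (zeroʳ _)

  VanishesFrom-mono : ∀ {w w′ M} → w ≤ w′ → VanishesFrom w M → VanishesFrom w′ M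
  VanishesFrom-mono w≤w′ M≈0 r c w′≤c = M≈0 r c (ℕ.≤-trans w≤w′ w′≤c)

  shiftRight-congʳ : ∀ o {g g′ : ℕ → Carrier} → g ≗ g′ → shiftRight o g ≗ shiftRight o g′
  shiftRight-congʳ zero    g≗g′ c       = g≗g′ c
  shiftRight-congʳ (suc o) g≗g′ zero    = ≡.refl
  shiftRight-congʳ (suc o) g≗g′ (suc c) = shiftRight-congʳ o g≗g′ c

  shiftRight-shiftRight : ∀ a b g → shiftRight a (shiftRight b g) ≗ shiftRight (a ℕ.+ b) g
  shiftRight-shiftRight zero    b g c       = ≡.refl
  shiftRight-shiftRight (suc a) b g zero    = ≡.refl
  shiftRight-shiftRight (suc a) b g (suc c) = shiftRight-shiftRight a b g c

  shiftRight-punchIn : ∀ o a g c → shiftRight o g (punchInℕ (o ℕ.+ a) c) ≡ shiftRight o (g ∘ punchInℕ a) c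
  shiftRight-punchIn zero    a g c       = ≡.refl
  shiftRight-punchIn (suc o) a g zero    = ≡.refl
  shiftRight-punchIn (suc o) a g (suc c) = shiftRight-punchIn o a g c

  shiftRight-vanishes : ∀ o {w} (g : ℕ → Carrier) → (∀ x → w ≤ x → g x ≈ 0#) → ∀ c → o ℕ.+ w ≤ c → shiftRight o g c ≈ 0#
  shiftRight-vanishes zero    g g≈0 c       w≤c       = g≈0 c w≤c
  shiftRight-vanishes (suc o) g g≈0 (suc c) (s≤s w≤c) = shiftRight-vanishes o g g≈0 c w≤c

  sgn-double-+ : ∀ m j → sgn (double m ℕ.+ j) ≈ sgn j
  sgn-double-+ zero    j = refl
  sgn-double-+ (suc m) j = trans (⁻¹-involutive _) (sgn-double-+ m j)

  sumℕ-shiftRight : ∀ o k (g : ℕ → Carrier) (Φ : ℕ → Carrier → Carrier) → (∀ j → Φ j 0# ≈ 0#) →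
    sumℕ (o ℕ.+ k) (λ j → Φ j (shiftRight o g j)) ≈ sumℕ k (λ j → Φ (o ℕ.+ j) (g j))
  sumℕ-shiftRight zero    k g Φ Φ0≈0 = refl
  sumℕ-shiftRight (suc o) k g Φ Φ0≈0 = begin
    Φ 0 0# + sumℕ (o ℕ.+ k) (λ j → Φ (suc j) (shiftRight o g j))
      ≈⟨ +-cong (Φ0≈0 0) (sumℕ-shiftRight o k g (Φ ∘ suc) (Φ0≈0 ∘ suc)) ⟩
    0# + sumℕ k (λ j → Φ (suc (o ℕ.+ j)) (g j))
      ≈⟨ +-identityˡ _ ⟩
    sumℕ k (λ j → Φ (suc (o ℕ.+ j)) (g j))
      ∎

  detℕ-shiftedTopRow : ∀ o k n h M → suc n ≡ o ℕ.+ k →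
    detℕ (suc n) (shiftRight o h ◂ M) ≈ sumℕ k (λ j → sgn (o ℕ.+ j) * h j * detℕ n (removeColumn (o ℕ.+ j) M))
  detℕ-shiftedTopRow o k n h M size = trans
    (reflexive (≡.cong (λ z → sumℕ z (λ j → sgn j * shiftRight o h j * detℕ n (removeColumn j M))) size))
    (sumℕ-shiftRight o k h (λ j x → sgn j * x * detℕ n (removeColumn j M)) (λ j → trans (*-congʳ (zeroʳ _)) (zeroˡ _)))

  detWithoutColumn : ℕ → ℕ → Grid → Carrier
  detWithoutColumn n j M = detℕ n (removeColumn j M)

  module _ (m : ℕ) (h : ℕ → Carrier) (M : Grid) where
    private
      n = double m
      X Y : ℕ → Carrier
      X a = detWithoutColumn (suc n) (n ℕ.+ a) M
      Y a = detWithoutColumn (2 ℕ.+ n) (n ℕ.+ a) M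

    detℕ-shiftedTopRow₂ : detℕ (2 ℕ.+ double m) (shiftRight (double m) h ◂ M)
      ≈ h 0 * detWithoutColumn (suc (double m)) (double m ℕ.+ 0) M - h 1 * detWithoutColumn (suc (double m)) (double m ℕ.+ 1) M
    detℕ-shiftedTopRow₂ = begin
      detℕ (2 ℕ.+ n) (shiftRight n h ◂ M)
        ≈⟨ detℕ-shiftedTopRow n 2 (suc n) h M (ℕ.+-comm 2 n) ⟩
      sgn (n ℕ.+ 0) * h 0 * X 0 + (sgn (n ℕ.+ 1) * h 1 * X 1 + 0#)
        ≈⟨ +-cong (*-congʳ (*-congʳ (sgn-double-+ m 0))) (+-congʳ (*-congʳ (*-congʳ (sgn-double-+ m 1)))) ⟩
      1# * h 0 * X 0 + (- 1# * h 1 * X 1 + 0#)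
        ≈⟨ solve 4 (λ a b x y → con (+ 1) :* a :* x :+ ((:- con (+ 1)) :* b :* y :+ con (+ 0))
                                := a :* x :- b :* y) refl (h 0) (h 1) (X 0) (X 1) ⟩
      h 0 * X 0 - h 1 * X 1
        ∎

    detℕ-shiftedTopRow₃ : detℕ (3 ℕ.+ double m) (shiftRight (double m) h ◂ M)
      ≈ h 0 * detWithoutColumn (2 ℕ.+ double m) (double m ℕ.+ 0) M - h 1 * detWithoutColumn (2 ℕ.+ double m) (double m ℕ.+ 1) M
        + h 2 * detWithoutColumn (2 ℕ.+ double m) (double m ℕ.+ 2) M
    detℕ-shiftedTopRow₃ = begin
      detℕ (3 ℕ.+ n) (shiftRight n h ◂ M)
        ≈⟨ detℕ-shiftedTopRow n 3 (suc (suc n)) h M (ℕ.+-comm 3 n) ⟩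
      sgn (n ℕ.+ 0) * h 0 * Y 0 + (sgn (n ℕ.+ 1) * h 1 * Y 1 + (sgn (n ℕ.+ 2) * h 2 * Y 2 + 0#))
        ≈⟨ +-cong (*-congʳ (*-congʳ (sgn-double-+ m 0))) (+-cong (*-congʳ (*-congʳ (sgn-double-+ m 1)))
             (+-congʳ (*-congʳ (*-congʳ (sgn-double-+ m 2))))) ⟩
      1# * h 0 * Y 0 + (- 1# * h 1 * Y 1 + (- - 1# * h 2 * Y 2 + 0#))
        ≈⟨ solve 6 (λ a b c x y z → con (+ 1) :* a :* x :+ ((:- con (+ 1)) :* b :* y
                                      :+ ((:- (:- con (+ 1))) :* c :* z :+ con (+ 0)))
                                    := a :* x :- b :* y :+ c :* z) refl (h 0) (h 1) (h 2) (Y 0) (Y 1) (Y 2) ⟩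
      h 0 * Y 0 - h 1 * Y 1 + h 2 * Y 2
        ∎

module Staircase {c ℓ : Level} (R : CommutativeRing c ℓ) where
  open CommutativeRing R hiding (zero)
  open DRH R using (Domino; Block; det; stack)
  open GridDeterminant R
  open IntegerCoefficientSolver R using (solve; _:=_; _:+_; _:*_; _:-_; :-_; con)
  open import Relation.Binary.Reasoning.Setoid setoid

  topRow bottomRow : Block → Domino
  topRow    b = b fz
  bottomRow b = b (fs fz)

  dominoRow : Domino → ℕ → Carrier
  dominoRow u zero          = u fz
  dominoRow u (suc zero)    = u (fs fz)
  dominoRow u (suc (suc _)) = 0#

  pairRow : Domino → Domino → ℕ → Carrier
  pairRow u v 0 = u fz
  pairRow u v 1 = u (fs fz)
  pairRow u v 2 = v fz
  pairRow u v 3 = v (fs fz)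
  pairRow u v (suc (suc (suc (suc _)))) = 0#

  -- Rows of b₁ b₂ ⋯ counted from the bottom: the blocks B (2i), B (2i+1) sit
  -- side by side in rows 2i, 2i+1 and columns 2i, …, 2i+3.
  blockRows : (ℕ → Block) → ℕ → ℕ → Carrier
  blockRows B 0             = pairRow (bottomRow (B 0)) (bottomRow (B 1))
  blockRows B 1             = pairRow (topRow (B 0)) (topRow (B 1))
  blockRows B (suc (suc r)) = shiftRight 2 (blockRows (λ i → B (suc (suc i))) r)

  staircase : (ℕ → Block) → Domino → Grid
  staircase B s zero    = dominoRow s
  staircase B s (suc r) = blockRows B r

  -- s b₁ ⋯ b₂ₘ as a (2m+1) × (2m+2) matrix, rows read top to bottom.
  stairs : (ℕ → Block) → Domino → ℕ → Grid
  stairs B s m r = staircase B s (double m ∸ r)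

  endMinor : (ℕ → Block) → Domino → ℕ → ℕ → Carrier
  endMinor B s m j = detWithoutColumn (suc (double m)) (double m ℕ.+ j) (stairs B s m)

  blockRows-bottom : ∀ m B → blockRows B (double m) ≗
    shiftRight (double m) (pairRow (bottomRow (B (double m))) (bottomRow (B (suc (double m)))))
  blockRows-bottom zero    B c = ≡.refl
  blockRows-bottom (suc m) B c = ≡.trans
    (shiftRight-congʳ 2 (blockRows-bottom m (λ i → B (suc (suc i)))) c) (shiftRight-shiftRight 2 (double m) _ c)

  blockRows-top : ∀ m B → blockRows B (suc (double m)) ≗
    shiftRight (double m) (pairRow (topRow (B (double m))) (topRow (B (suc (double m)))))
  blockRows-top zero    B c = ≡.refl
  blockRows-top (suc m) B c = ≡.trans
    (shiftRight-congʳ 2 (blockRows-top m (λ i → B (suc (suc i)))) c) (shiftRight-shiftRight 2 (double m) _ c)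

  pairRow-vanishes : ∀ u v x → 4 ≤ x → pairRow u v x ≈ 0#
  pairRow-vanishes u v x (s≤s (s≤s (s≤s (s≤s _)))) = refl

  stairs-vanishesFrom : ∀ B s m → VanishesFrom (2 ℕ.+ double m) (stairs B s m)
  stairs-vanishesFrom B s zero r c (s≤s (s≤s _)) rewrite ℕ.0∸n≡0 r = refl
  stairs-vanishesFrom B s (suc m) zero c 4+n≤c = trans (reflexive (blockRows-top m B c))
    (shiftRight-vanishes (double m) _ (pairRow-vanishes _ _) c (ℕ.≤-trans (ℕ.≤-reflexive (ℕ.+-comm (double m) 4)) 4+n≤c))
  stairs-vanishesFrom B s (suc m) (suc zero) c 4+n≤c = trans (reflexive (blockRows-bottom m B c))
    (shiftRight-vanishes (double m) _ (pairRow-vanishes _ _) c (ℕ.≤-trans (ℕ.≤-reflexive (ℕ.+-comm (double m) 4)) 4+n≤c))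
  stairs-vanishesFrom B s (suc m) (suc (suc r)) c 4+n≤c =
    stairs-vanishesFrom B s m r c (ℕ.≤-trans (ℕ.n≤1+n _) (ℕ.≤-trans (ℕ.n≤1+n _) 4+n≤c))

  module _ (B : ℕ → Block) (s : Domino) (m j : ℕ) where
    private
      n = double m
      A = endMinor B s m
      S = stairs B s m
      wT wB : ℕ → Carrier
      wT x = pairRow (topRow (B n)) (topRow (B (suc n))) (punchInℕ (2 ℕ.+ j) x)
      wB x = pairRow (bottomRow (B n)) (bottomRow (B (suc n))) (punchInℕ (2 ℕ.+ j) x)
      Q : Grid
      Q = removeColumn (2 ℕ.+ (n ℕ.+ j)) (dropRow (stairs B s (suc m)))

      offset : 2 ℕ.+ (n ℕ.+ j) ≡ n ℕ.+ (2 ℕ.+ j)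
      offset = ≡.sym (≡.trans (ℕ.+-suc n (suc j)) (≡.cong suc (ℕ.+-suc n j)))

      punchShifted : ∀ (g : ℕ → Carrier) c →
        shiftRight n g (punchInℕ (2 ℕ.+ (n ℕ.+ j)) c) ≡ shiftRight n (g ∘ punchInℕ (2 ℕ.+ j)) c
      punchShifted g c = ≡.trans (≡.cong (λ k → shiftRight n g (punchInℕ k c)) offset) (shiftRight-punchIn n (2 ℕ.+ j) g c)

      S-vanishes : VanishesFrom (2 ℕ.+ n) S
      S-vanishes = stairs-vanishesFrom B s m

      removeColumn-S : ∀ a → 2 ℕ.+ n ≤ a → ∀ r c → removeColumn a S r c ≈ S r c
      removeColumn-S a 2+n≤a = removeColumn-beyond a S-vanishes 2+n≤a

      splitTopRow : ∀ r c → removeColumn (2 ℕ.+ (n ℕ.+ j)) (stairs B s (suc m)) r c ≈ (shiftRight n wT ◂ Q) r c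
      splitTopRow zero    c = reflexive (≡.trans (blockRows-top m B _) (punchShifted _ c))
      splitTopRow (suc r) c = refl

      D : ℕ → Carrier
      D a = detWithoutColumn (2 ℕ.+ n) (n ℕ.+ a) Q

      doubleMinor : ℕ → ℕ → Carrier
      doubleMinor b a = detWithoutColumn (suc n) (n ℕ.+ b) (removeColumn (n ℕ.+ a) S)

      D≈window : ∀ a → D a ≈ wB (punchInℕ a 0) * doubleMinor 0 a - wB (punchInℕ a 1) * doubleMinor 1 a
      D≈window a = trans (detℕ-cong (2 ℕ.+ n) rows) (detℕ-shiftedTopRow₂ m (wB ∘ punchInℕ a) (removeColumn (n ℕ.+ a) S))
        where
        rows : ∀ r x → removeColumn (n ℕ.+ a) Q r x ≈ (shiftRight n (wB ∘ punchInℕ a) ◂ removeColumn (n ℕ.+ a) S) r x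
        rows zero    x = reflexive (≡.trans (≡.trans (blockRows-bottom m B _) (punchShifted _ _)) (shiftRight-punchIn n a wB x))
        rows (suc r) x = removeColumn-S (2 ℕ.+ (n ℕ.+ j)) (s≤s (s≤s (ℕ.m≤m+n n j))) r _

      S-without-vanishes : ∀ a → a ≤ 1 → VanishesFrom (n ℕ.+ 1) (removeColumn (n ℕ.+ a) S)
      S-without-vanishes a a≤1 = removeColumn-vanishesFrom (n ℕ.+ a)
        (VanishesFrom-mono (s≤s (ℕ.≤-reflexive (≡.sym (ℕ.+-comm n 1)))) S-vanishes) (ℕ.+-monoʳ-≤ n a≤1)

      -- column n of this minor is column n + 2 of S
      doubleMinor-0≈0 : ∀ a → a ≤ 1 → doubleMinor 0 a ≈ 0#
      doubleMinor-0≈0 a a≤1 = detℕ-zeroColumn (suc n) (removeColumn (n ℕ.+ 0) (removeColumn (n ℕ.+ a) S)) n ℕ.≤-refl (λ r →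
        trans (reflexive (≡.cong (removeColumn (n ℕ.+ a) S r) (punchInℕ-≥ (ℕ.≤-reflexive (ℕ.+-identityʳ n)))))
              (S-without-vanishes a a≤1 r (suc n) (ℕ.≤-reflexive (ℕ.+-comm n 1))))

      doubleMinor-1≈A : ∀ a → a ≤ 1 → doubleMinor 1 a ≈ A a
      doubleMinor-1≈A a a≤1 = detℕ-cong (suc n) (removeColumn-beyond (n ℕ.+ 1) (S-without-vanishes a a≤1) ℕ.≤-refl)

      doubleMinor-b2≈A : ∀ b → doubleMinor b 2 ≈ A b
      doubleMinor-b2≈A b = detℕ-cong (suc n) (λ r c →
        removeColumn-S (n ℕ.+ 2) (ℕ.≤-reflexive (ℕ.+-comm 2 n)) r (punchInℕ (n ℕ.+ b) c))

      D-low : ∀ a → a ≤ 1 → D a ≈ wB (punchInℕ a 0) * 0# - wB (punchInℕ a 1) * A a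
      D-low a a≤1 = trans (D≈window a) (+-cong (*-congˡ (doubleMinor-0≈0 a a≤1)) (-‿cong (*-congˡ (doubleMinor-1≈A a a≤1))))

      D-high : D 2 ≈ wB 0 * A 0 - wB 1 * A 1
      D-high = trans (D≈window 2) (+-cong (*-congˡ (doubleMinor-b2≈A 0)) (-‿cong (*-congˡ (doubleMinor-b2≈A 1))))

    endMinor-step : endMinor B s (suc m) j ≈ A 0 * (wT 2 * wB 0 - wB 2 * wT 0) - A 1 * (wT 2 * wB 1 - wB 2 * wT 1)
    endMinor-step = begin
      endMinor B s (suc m) j
        ≈⟨ detℕ-cong (3 ℕ.+ n) splitTopRow ⟩
      detℕ (3 ℕ.+ n) (shiftRight n wT ◂ Q)
        ≈⟨ detℕ-shiftedTopRow₃ m wT Q ⟩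
      wT 0 * D 0 - wT 1 * D 1 + wT 2 * D 2
        ≈⟨ +-cong (+-cong (*-congˡ (D-low 0 z≤n)) (-‿cong (*-congˡ (D-low 1 (s≤s z≤n))))) (*-congˡ D-high) ⟩
      wT 0 * (wB 1 * 0# - wB 2 * A 0) - wT 1 * (wB 0 * 0# - wB 2 * A 1) + wT 2 * (wB 0 * A 0 - wB 1 * A 1)
        ≈⟨ solve 8 (λ t₀ t₁ t₂ b₀ b₁ b₂ a₀ a₁ →
             t₀ :* (b₁ :* con (+ 0) :- b₂ :* a₀) :- t₁ :* (b₀ :* con (+ 0) :- b₂ :* a₁) :+ t₂ :* (b₀ :* a₀ :- b₁ :* a₁)
             := a₀ :* (t₂ :* b₀ :- b₂ :* t₀) :- a₁ :* (t₂ :* b₁ :- b₂ :* t₁))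
           refl (wT 0) (wT 1) (wT 2) (wB 0) (wB 1) (wB 2) (A 0) (A 1) ⟩
      A 0 * (wT 2 * wB 0 - wB 2 * wT 0) - A 1 * (wT 2 * wB 1 - wB 2 * wT 1)
        ∎

  -- The 2 × 2 determinant of the pair of end-minor vectors is multiplied by
  -- det U · det V when the blocks U, V are added on top.
  transfer-det : ∀ x₀ x₁ y₀ y₁ u₀₀ u₀₁ u₁₀ u₁₁ v₀₀ v₀₁ v₁₀ v₁₁ →
    (x₀ * (v₀₀ * u₁₀ - v₁₀ * u₀₀) - x₁ * (v₀₀ * u₁₁ - v₁₀ * u₀₁)) * (y₀ * (v₀₁ * u₁₀ - v₁₁ * u₀₀) - y₁ * (v₀₁ * u₁₁ - v₁₁ * u₀₁))
    - (x₀ * (v₀₁ * u₁₀ - v₁₁ * u₀₀) - x₁ * (v₀₁ * u₁₁ - v₁₁ * u₀₁)) * (y₀ * (v₀₀ * u₁₀ - v₁₀ * u₀₀) - y₁ * (v₀₀ * u₁₁ - v₁₀ * u₀₁))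
    ≈ (u₀₀ * u₁₁ - u₀₁ * u₁₀) * (v₀₀ * v₁₁ - v₀₁ * v₁₀) * (x₁ * y₀ - x₀ * y₁)
  transfer-det = solve 12 (λ x₀ x₁ y₀ y₁ u₀₀ u₀₁ u₁₀ u₁₁ v₀₀ v₀₁ v₁₀ v₁₁ →
    (x₀ :* (v₀₀ :* u₁₀ :- v₁₀ :* u₀₀) :- x₁ :* (v₀₀ :* u₁₁ :- v₁₀ :* u₀₁))
      :* (y₀ :* (v₀₁ :* u₁₀ :- v₁₁ :* u₀₀) :- y₁ :* (v₀₁ :* u₁₁ :- v₁₁ :* u₀₁))
    :- (x₀ :* (v₀₁ :* u₁₀ :- v₁₁ :* u₀₀) :- x₁ :* (v₀₁ :* u₁₁ :- v₁₁ :* u₀₁))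
      :* (y₀ :* (v₀₀ :* u₁₀ :- v₁₀ :* u₀₀) :- y₁ :* (v₀₀ :* u₁₁ :- v₁₀ :* u₀₁))
    := (u₀₀ :* u₁₁ :- u₀₁ :* u₁₀) :* (v₀₀ :* v₁₁ :- v₀₁ :* v₁₀) :* (x₁ :* y₀ :- x₀ :* y₁)) refl

  endMinor-wronskian : ∀ B s s̃ m →
    endMinor B s m 1 * endMinor B s̃ m 0 - endMinor B s m 0 * endMinor B s̃ m 1
      ≈ det (stack s s̃) * prodℕ (double m) (λ i → det (B i))
  endMinor-wronskian B s s̃ zero =
    solve 4 (λ a b c d →
      (con (+ 1) :* a :* con (+ 1) :+ con (+ 0)) :* (con (+ 1) :* d :* con (+ 1) :+ con (+ 0))
        :- (con (+ 1) :* b :* con (+ 1) :+ con (+ 0)) :* (con (+ 1) :* c :* con (+ 1) :+ con (+ 0))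
      := (con (+ 1) :* a :* (con (+ 1) :* d :* con (+ 1) :+ con (+ 0))
           :+ ((:- con (+ 1)) :* b :* (con (+ 1) :* c :* con (+ 1) :+ con (+ 0)) :+ con (+ 0))) :* con (+ 1))
    refl (s fz) (s (fs fz)) (s̃ fz) (s̃ (fs fz))
  endMinor-wronskian B s s̃ (suc m) = begin
    endMinor B s (suc m) 1 * endMinor B s̃ (suc m) 0 - endMinor B s (suc m) 0 * endMinor B s̃ (suc m) 1
      ≈⟨ +-cong (*-cong (endMinor-step B s m 1) (endMinor-step B s̃ m 0))
                (-‿cong (*-cong (endMinor-step B s m 0) (endMinor-step B s̃ m 1))) ⟩
    _ ≈⟨ transfer-det _ _ _ _ _ _ _ _ _ _ _ _ ⟩
    (U fz fz * U (fs fz) (fs fz) - U fz (fs fz) * U (fs fz) fz)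
      * (V fz fz * V (fs fz) (fs fz) - V fz (fs fz) * V (fs fz) fz)
      * (endMinor B s m 1 * endMinor B s̃ m 0 - endMinor B s m 0 * endMinor B s̃ m 1)
      ≈⟨ *-cong (*-cong (sym (det-2×2 U)) (sym (det-2×2 V))) (endMinor-wronskian B s s̃ m) ⟩
    det U * det V * (det (stack s s̃) * prodℕ n detB)
      ≈⟨ solve 4 (λ u v w p → u :* v :* (w :* p) := w :* (p :* u :* v)) refl (det U) (det V) (det (stack s s̃)) (prodℕ n detB) ⟩
    det (stack s s̃) * (prodℕ n detB * det U * det V)
      ≈⟨ *-congˡ (trans (prodℕ-snoc (suc n) detB) (*-congʳ (prodℕ-snoc n detB))) ⟨
    det (stack s s̃) * prodℕ (2 ℕ.+ n) detB
      ∎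
    where
    n = double m
    U = B n
    V = B (suc n)
    detB : ℕ → Carrier
    detB i = det (B i)

module Placement {c ℓ : Level} (R : CommutativeRing c ℓ) where
  open CommutativeRing R using (Carrier; 0#)
  open DRH R
  open GridDeterminant R using (shiftRight; shiftRight-congʳ; shiftRight-shiftRight)
  open Staircase R using (dominoRow; pairRow; topRow; bottomRow; blockRows; staircase)

  placeAll : ℕ → ℕ → Dir → List Piece → ℕ → ℕ → Carrier
  placeAll x y d []       r c = 0#
  placeAll x y d (p ∷ ps) r c = place x y d p ps r c

  covers : ℕ → ℕ → Piece → ℕ → ℕ → Bool
  covers x y p r c = (x ≤ᵇ c) ∧ (c <ᵇ x ℕ.+ width p) ∧ (y ≤ᵇ r) ∧ (r <ᵇ y ℕ.+ height p)

  place-unfold : ∀ x y d p ps r c → place x y d p ps r c ≡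
    (if covers x y p r c then pieceAt p ((y ℕ.+ height p ∸ 1) ∸ r) (c ∸ x)
     else placeAll (nextX d x y p) (nextY d x y p) (flip d) ps r c)
  place-unfold x y d p []       r c = ≡.refl
  place-unfold x y d p (q ∷ qs) r c = ≡.refl

  place-uncovered : ∀ x y p r c d ps → covers x y p r c ≡ false →
    place x y d p ps r c ≡ placeAll (nextX d x y p) (nextY d x y p) (flip d) ps r c
  place-uncovered x y p r c d ps uncovered =
    ≡.trans (place-unfold x y d p ps r c) (≡.cong (λ b → if b then pieceAt p ((y ℕ.+ height p ∸ 1) ∸ r) (c ∸ x)
      else placeAll (nextX d x y p) (nextY d x y p) (flip d) ps r c) uncovered)

  ≤ᵇ-false : ∀ {m n} → n < m → (m ≤ᵇ n) ≡ false
  ≤ᵇ-false {m} {n} n<m with m ≤ᵇ n | ℕ.≤ᵇ⇒≤ m n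
  ... | false | _   = ≡.refl
  ... | true  | m≤n = contradiction (m≤n tt) (ℕ.<⇒≱ n<m)

  suc-≤ᵇ : ∀ m n → (suc m ≤ᵇ suc n) ≡ (m ≤ᵇ n)
  suc-≤ᵇ zero    n = ≡.refl
  suc-≤ᵇ (suc m) n = ≡.refl

  x≤nextX : ∀ d x y p → x ≤ nextX d x y p
  x≤nextX above x y p = ℕ.≤-refl
  x≤nextX right x y p = ℕ.m≤m+n x (width p)

  y≤nextY : ∀ d x y p → y ≤ nextY d x y p
  y≤nextY above x y p = ℕ.m≤m+n y (height p)
  y≤nextY right x y p = ℕ.≤-refl

  nextX-suc : ∀ d x y p → nextX d (suc x) (suc y) p ≡ suc (nextX d x y p)
  nextX-suc above x y p = ≡.refl
  nextX-suc right x y p = ≡.refl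

  nextY-suc : ∀ d x y p → nextY d (suc x) (suc y) p ≡ suc (nextY d x y p)
  nextY-suc above x y p = ≡.refl
  nextY-suc right x y p = ≡.refl

  placeAll-left : ∀ ps x y d r c → c < x → placeAll x y d ps r c ≡ 0#
  placeAll-left []       x y d r c c<x = ≡.refl
  placeAll-left (p ∷ ps) x y d r c c<x = ≡.trans
    (place-uncovered x y p r c d ps (≡.cong (_∧ ((c <ᵇ x ℕ.+ width p) ∧ (y ≤ᵇ r) ∧ (r <ᵇ y ℕ.+ height p))) (≤ᵇ-false c<x)))
    (placeAll-left ps _ _ _ r c (ℕ.<-≤-trans c<x (x≤nextX d x y p)))

  placeAll-below : ∀ ps x y d r c → r < y → placeAll x y d ps r c ≡ 0#
  placeAll-below []       x y d r c r<y = ≡.refl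
  placeAll-below (p ∷ ps) x y d r c r<y = ≡.trans
    (place-uncovered x y p r c d ps (≡.trans (≡.cong (λ b → (x ≤ᵇ c) ∧ (c <ᵇ x ℕ.+ width p) ∧ b ∧ (r <ᵇ y ℕ.+ height p)) (≤ᵇ-false r<y))
                                   (≡.trans (≡.cong ((x ≤ᵇ c) ∧_) (∧-zeroʳ _)) (∧-zeroʳ _))))
    (placeAll-below ps _ _ _ r c (ℕ.<-≤-trans r<y (y≤nextY d x y p)))

  placeAll-diagonal : ∀ ps x y d r c → placeAll (suc x) (suc y) d ps (suc r) (suc c) ≡ placeAll x y d ps r c
  placeAll-diagonal []       x y d r c = ≡.refl
  placeAll-diagonal (p ∷ ps) x y d r c
    rewrite place-unfold (suc x) (suc y) d p ps (suc r) (suc c)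
          | place-unfold x y d p ps r c
          | suc-≤ᵇ x c | suc-≤ᵇ y r
          | nextX-suc d x y p | nextY-suc d x y p
          | placeAll-diagonal ps (nextX d x y p) (nextY d x y p) (flip d) r c
          | ℕ.∸-+-assoc (y ℕ.+ height p) 1 r
          = ≡.refl

  placePair-lower : ∀ U V ps c → placeAll 0 1 right (blk U ∷ blk V ∷ ps) 1 c ≡ pairRow (bottomRow U) (bottomRow V) c
  placePair-lower U V ps 0 = ≡.refl
  placePair-lower U V ps 1 = ≡.refl
  placePair-lower U V ps 2 = ≡.refl
  placePair-lower U V ps 3 = ≡.refl
  placePair-lower U V ps (suc (suc (suc (suc c)))) =
    ≡.trans (place-uncovered 2 1 (blk V) 1 (4 ℕ.+ c) above ps ≡.refl) (placeAll-below ps 2 3 right 1 _ (s≤s (s≤s z≤n)))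

  placePair-upper : ∀ U V ps c → placeAll 0 1 right (blk U ∷ blk V ∷ ps) 2 c ≡ pairRow (topRow U) (topRow V) c
  placePair-upper U V ps 0 = ≡.refl
  placePair-upper U V ps 1 = ≡.refl
  placePair-upper U V ps 2 = ≡.refl
  placePair-upper U V ps 3 = ≡.refl
  placePair-upper U V ps (suc (suc (suc (suc c)))) =
    ≡.trans (place-uncovered 2 1 (blk V) 2 (4 ℕ.+ c) above ps ≡.refl) (placeAll-below ps 2 3 right 2 _ (s≤s (s≤s (s≤s z≤n))))

  placePair-above : ∀ U V ps r c →
    placeAll 0 1 right (blk U ∷ blk V ∷ ps) (3 ℕ.+ r) c ≡ shiftRight 2 (placeAll 0 1 right ps (suc r)) c
  placePair-above U V ps r 0 = ≡.trans (place-uncovered 2 1 (blk V) (3 ℕ.+ r) 0 above ps ≡.refl) (placeAll-left ps 2 3 right _ 0 (s≤s z≤n))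
  placePair-above U V ps r 1 = ≡.trans (place-uncovered 2 1 (blk V) (3 ℕ.+ r) 1 above ps ≡.refl) (placeAll-left ps 2 3 right _ 1 (s≤s (s≤s z≤n)))
  placePair-above U V ps r (suc (suc c)) = ≡.trans (place-uncovered 2 1 (blk V) (3 ℕ.+ r) (2 ℕ.+ c) above ps (∧-zeroʳ (c <ᵇ 2)))
    (≡.trans (placeAll-diagonal ps 1 2 right (2 ℕ.+ r) (suc c)) (placeAll-diagonal ps 0 1 right (suc r) c))

  blockSequence : ∀ {k} → (Fin k → Block) → ℕ → Block
  blockSequence {zero}  b i       _ _ = 0#
  blockSequence {suc k} b zero    = b fz
  blockSequence {suc k} b (suc i) = blockSequence (b ∘ fs) i

  blockSequence-toℕ : ∀ {k} (b : Fin k → Block) i → blockSequence b (toℕ i) ≡ b i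
  blockSequence-toℕ b fz     = ≡.refl
  blockSequence-toℕ b (fs i) = blockSequence-toℕ (b ∘ fs) i

  pieces : ∀ {k} → (Fin k → Block) → Domino → List Piece
  pieces b f = map blk (tabulate b) ++ hdom f ∷ []

  placeAll-blockRows : ∀ m (b : Fin (double m) → Block) f r c → r < double m →
    placeAll 0 1 right (pieces b f) (suc r) c ≡ blockRows (blockSequence b) r c
  placeAll-blockRows (suc m) b f 0 c _ = placePair-lower (b fz) (b (fs fz)) (pieces (b ∘ fs ∘ fs) f) c
  placeAll-blockRows (suc m) b f 1 c _ = placePair-upper (b fz) (b (fs fz)) (pieces (b ∘ fs ∘ fs) f) c
  placeAll-blockRows (suc m) b f (suc (suc r)) c (s≤s (s≤s r<2m)) = ≡.trans (placePair-above (b fz) (b (fs fz)) (pieces (b ∘ fs ∘ fs) f) r c)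
    (shiftRight-congʳ 2 (λ c′ → placeAll-blockRows m (b ∘ fs ∘ fs) f r c′ r<2m) c)

  placeAll-topRow : ∀ m (b : Fin (double m) → Block) f c →
    placeAll 0 1 right (pieces b f) (suc (double m)) c ≡ shiftRight (double m) (dominoRow f) c
  placeAll-topRow zero    b f 0             = ≡.refl
  placeAll-topRow zero    b f 1             = ≡.refl
  placeAll-topRow zero    b f (suc (suc c)) = ≡.refl
  placeAll-topRow (suc m) b f c = ≡.trans (placePair-above (b fz) (b (fs fz)) (pieces (b ∘ fs ∘ fs) f) (double m) c)
    (≡.trans (shiftRight-congʳ 2 (placeAll-topRow m (b ∘ fs ∘ fs) f) c) (shiftRight-shiftRight 2 (double m) _ c))

  placeBottomDomino : ∀ s ps c → place 0 0 above (hdom s) ps 0 c ≡ dominoRow s c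
  placeBottomDomino s ps 0             = ≡.refl
  placeBottomDomino s ps 1             = ≡.refl
  placeBottomDomino s ps (suc (suc c)) =
    ≡.trans (place-uncovered 0 0 (hdom s) 0 (suc (suc c)) above ps ≡.refl) (placeAll-below ps 0 1 right 0 _ (s≤s z≤n))

  placeAboveDomino : ∀ s ps r c → place 0 0 above (hdom s) ps (suc r) c ≡ placeAll 0 1 right ps (suc r) c
  placeAboveDomino s ps r c = place-uncovered 0 0 (hdom s) (suc r) c above ps (∧-zeroʳ (c <ᵇ 2))

  sbf-staircase : ∀ m (b : Fin (double m) → Block) s f r c → r ≤ double m →
    place 0 0 above (hdom s) (pieces b f) r c ≡ staircase (blockSequence b) s r c
  sbf-staircase m b s f zero    c _      = placeBottomDomino s (pieces b f) c
  sbf-staircase m b s f (suc r) c r<2m = ≡.trans (placeAboveDomino s (pieces b f) r c) (placeAll-blockRows m b f r c r<2m)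

  sbf-topRow : ∀ m (b : Fin (double m) → Block) s f c →
    place 0 0 above (hdom s) (pieces b f) (suc (double m)) c ≡ shiftRight (double m) (dominoRow f) c
  sbf-topRow m b s f c = ≡.trans (placeAboveDomino s (pieces b f) (double m) c) (placeAll-topRow m b f c)

module SBFDeterminant {c ℓ : Level} (R : CommutativeRing c ℓ) where
  open CommutativeRing R hiding (zero)
  open DRH R
  open GridDeterminant R
  open Staircase R
  open Placement R
  open IntegerCoefficientSolver R using (solve; _:=_; _:*_; _:-_)
  open import Relation.Binary.Reasoning.Setoid setoid

  det-drhSBF : ∀ m (b : Fin (double m) → Block) s f →
    det (drhSBF (double m) s b f) ≈ f fz * endMinor (blockSequence b) s m 0 - f (fs fz) * endMinor (blockSequence b) s m 1
  det-drhSBF m b s f = begin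
    det (drhSBF (double m) s b f)
      ≈⟨ det≈detℕ (double m ℕ.+ 2) _ capped (λ i j → reflexive (entries (toℕ i) (toℕ j))) ⟩
    detℕ (double m ℕ.+ 2) capped
      ≡⟨ ≡.cong (λ n → detℕ n capped) (ℕ.+-comm (double m) 2) ⟩
    detℕ (2 ℕ.+ double m) capped
      ≈⟨ detℕ-shiftedTopRow₂ m (dominoRow f) (stairs B s m) ⟩
    f fz * endMinor B s m 0 - f (fs fz) * endMinor B s m 1
      ∎
    where
    B = blockSequence b
    capped = shiftRight (double m) (dominoRow f) ◂ stairs B s m
    top : double m ℕ.+ 2 ∸ 1 ≡ suc (double m)
    top = ≡.cong (_∸ 1) (ℕ.+-comm (double m) 2)
    entries : ∀ r c → place 0 0 above (hdom s) (pieces b f) ((double m ℕ.+ 2 ∸ 1) ∸ r) c ≡ capped r c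
    entries zero    c rewrite top = sbf-topRow m b s f c
    entries (suc r) c rewrite top = sbf-staircase m b s f (double m ∸ r) c (ℕ.m∸n≤m (double m) r)

  product-difference : ∀ a₀ a₁ b₀ b₁ x₀ x₁ y₀ y₁ →
    (a₀ * x₀ - a₁ * x₁) * (b₀ * y₀ - b₁ * y₁) - (b₀ * x₀ - b₁ * x₁) * (a₀ * y₀ - a₁ * y₁)
      ≈ (x₁ * y₀ - x₀ * y₁) * (a₀ * b₁ - a₁ * b₀)
  product-difference = solve 8 (λ a₀ a₁ b₀ b₁ x₀ x₁ y₀ y₁ →
    (a₀ :* x₀ :- a₁ :* x₁) :* (b₀ :* y₀ :- b₁ :* y₁) :- (b₀ :* x₀ :- b₁ :* x₁) :* (a₀ :* y₀ :- a₁ :* y₁)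
    := (x₁ :* y₀ :- x₀ :* y₁) :* (a₀ :* b₁ :- a₁ :* b₀)) refl

  sbf-identity : ∀ m (s s̃ f f̃ : Domino) (b : Fin (double m) → Block) →
    det (drhSBF (double m) s b f̃) * det (drhSBF (double m) s̃ b f) - det (drhSBF (double m) s b f) * det (drhSBF (double m) s̃ b f̃)
      ≈ det (stack s s̃) * prodFin (double m) (λ i → det (b i)) * det (stack f̃ f)
  sbf-identity m s s̃ f f̃ b = begin
    det (drhSBF (double m) s b f̃) * det (drhSBF (double m) s̃ b f) - det (drhSBF (double m) s b f) * det (drhSBF (double m) s̃ b f̃)
      ≈⟨ +-cong (*-cong (det-drhSBF m b s f̃) (det-drhSBF m b s̃ f)) (-‿cong (*-cong (det-drhSBF m b s f) (det-drhSBF m b s̃ f̃))) ⟩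
    _ ≈⟨ product-difference _ _ _ _ _ _ _ _ ⟩
    (endMinor B s m 1 * endMinor B s̃ m 0 - endMinor B s m 0 * endMinor B s̃ m 1) * (f̃ fz * f (fs fz) - f̃ (fs fz) * f fz)
      ≈⟨ *-cong (endMinor-wronskian B s s̃ m) (sym (det-2×2 (stack f̃ f))) ⟩
    det (stack s s̃) * prodℕ (double m) (λ i → det (B i)) * det (stack f̃ f)
      ≈⟨ *-congʳ (*-congˡ (prodFin≈prodℕ (double m) _ _ (λ i → reflexive (≡.cong det (≡.sym (blockSequence-toℕ b i)))))) ⟨
    det (stack s s̃) * prodFin (double m) (λ i → det (b i)) * det (stack f̃ f)
      ∎
    where
    B = blockSequence b

corollary7p10 : {c ℓ : Level} (R : CommutativeRing c ℓ) →
    let open CommutativeRing R in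
    let open DRH R in
    (k : ℕ) → 2 ∣ k → 0 < k →
    (s s̃ f f̃ : Domino) (b : Fin k → Block) →
    det (drhSBF k s b f̃) * det (drhSBF k s̃ b f) - det (drhSBF k s b f) * det (drhSBF k s̃ b f̃)
      ≈ det (stack s s̃) * prodFin k (λ i → det (b i)) * det (stack f̃ f)
corollary7p10 R k (divides m k≡m*2) _ rewrite k≡m*2 | ≡.sym (double≡*2 m) = SBFDeterminant.sbf-identity R m
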